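{- Let $k$ be a positive integer and let $G=(V,E)$ be a connected graph on $n=n(G)$ vertices with minimum degree $\delta$ and maximum degree $\Delta \geq k+1$. (i) If $\delta < \Delta = k+1$, then $F_k(G)=1$. (ii) If $\delta=\Delta=k+1$, then $F_k(G)=2$. (iii) If $\Delta \geq k+2$, then \[ F_k(G) \leq \frac{(\Delta-k-1)n + \max\{\delta(k+1-\Delta)+k,\; k(\delta-\Delta+2)\}}{\Delta-1}. \]
   Context: All graphs are simple, undirected and finite. Let $k$ be a positive integer. A set $S\subseteq V$ is a $k$-forcing set of $G$ if, when the vertices of $S$ are initially colored and all other vertices are initially non-colored, repeated application of the following color change rule eventually colors all vertices of $G$: a colored vertex with at most $k$ non-colored neighbors causes each of its non-colored neighbors to become colored. The $k$-forcing number $F_k(G)$ is the minimum cardinality of a $k$-forcing set of $G$. -}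

module Defs where

open import Data.Bool using (Bool; true; false; _∧_; _∨_; not)
open import Data.Nat using (ℕ; zero; suc; _≤_; _≤ᵇ_)
open import Data.Fin using (Fin; zero; suc)
open import Data.Fin.Subset using (Subset; _∩_; ∁; ∣_∣; ⊤)
open import Data.Vec using (tabulate; lookup)
open import Data.Product using (Σ; ∃; _×_)
open import Relation.Binary.PropositionalEquality using (_≡_)

record Graph (n : ℕ) : Set where
  field
    adj    : Fin n → Fin n → Bool
    sym    : ∀ u v → adj u v ≡ adj v u
    irrefl : ∀ v → adj v v ≡ false
open Graph public

N : ∀ {n} → Graph n → Fin n → Subset n
N G v = tabulate (adj G v)

deg : ∀ {n} → Graph n → Fin n → ℕ
deg G v = ∣ N G v ∣

IsMinDegree : ∀ {n} → Graph n → ℕ → Set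
IsMinDegree G d = (∀ v → d ≤ deg G v) × (∃ λ v → deg G v ≡ d)

IsMaxDegree : ∀ {n} → Graph n → ℕ → Set
IsMaxDegree G d = (∀ v → deg G v ≤ d) × (∃ λ v → deg G v ≡ d)

data Reachable {n} (G : Graph n) : Fin n → Fin n → Set where
  here : ∀ {v} → Reachable G v v
  step : ∀ {u w v} → adj G u w ≡ true → Reachable G w v → Reachable G u v

Connected : ∀ {n} → Graph n → Set
Connected G = ∀ u v → Reachable G u v

anyFin : ∀ {n} → (Fin n → Bool) → Bool
anyFin {zero}  f = false
anyFin {suc n} f = f zero ∨ anyFin (λ i → f (suc i))

uncoloredNbrs : ∀ {n} → Graph n → Subset n → Fin n → ℕ
uncoloredNbrs G S v = ∣ N G v ∩ ∁ S ∣

-- one application of the k-color change rule (all applicable forces at once):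
-- w becomes colored if it is colored or it is a neighbour of a colored v
-- that has at most k non-colored neighbours.
forceStep : ∀ {n} → ℕ → Graph n → Subset n → Subset n
forceStep k G S = tabulate λ w →
  lookup S w ∨ anyFin (λ v → lookup S v ∧ adj G v w ∧ (uncoloredNbrs G S v ≤ᵇ k))

iter : ∀ {A : Set} → ℕ → (A → A) → A → A
iter zero    f a = a
iter (suc m) f a = f (iter m f a)

IsKForcingSet : ∀ {n} → ℕ → Graph n → Subset n → Set
IsKForcingSet k G S = ∃ λ m → iter m (forceStep k G) S ≡ ⊤

IsKForcingNumber : ∀ {n} → ℕ → Graph n → ℕ → Set
IsKForcingNumber k G m =
  (∃ λ S → IsKForcingSet k G S × ∣ S ∣ ≡ m) ×
  (∀ S → IsKForcingSet k G S → m ≤ ∣ S ∣)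

module Submission where

-- Colour greedily. Call a colored set C admissible when each of its vertices has at most Δ − 1
-- non-colored neighbours; a vertex with a colored neighbour always qualifies. If C ≠ V, connectivity
-- yields u ∈ C with a nonempty set U of non-colored neighbours; colouring all but k vertices of U
-- lets u force the rest, and C ∪ U is again admissible. As |U| ≤ Δ − 1, the |U| − k added vertices
-- number at most (Δ − k − 1)|U|/(Δ − 1), so an admissible C extends to a k-forcing set with at most
-- (Δ − k − 1)(n − |C|)/(Δ − 1) extra vertices. For Δ = k + 1 nothing is added, so a vertex of degree
-- < Δ, or an edge, forces G; conversely the empty set, and in a (k + 1)-regular graph every single
-- vertex, forces nothing. For (iii), start from the closed neighbourhood of a vertex of degree δ,
-- at a cost of 1 + (δ − k) vertices.

open import Defs renaming (sym to adj-sym)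
open import Data.Bool using (Bool; true; false; _∧_; _∨_)
open import Data.Bool.Properties using (∨-zeroʳ; T-≡)
open import Data.Empty using (⊥-elim)
open import Data.Fin using (Fin)
open import Data.Fin.Properties using (all?; ¬∀⟶∃¬)
open import Data.Fin.Subset using (Subset; _∈_; _∉_; _⊆_; _∪_; _∩_; _─_; ∁; ⁅_⁆; ∣_∣; Nonempty; ⊤; ⊥)
open import Data.Fin.Subset.Properties
open import Data.Nat using (ℕ; zero; suc; _+_; _∸_; _≤_; _<_; _≤ᵇ_; _≤?_; z≤n; s≤s; NonZero)
open import Data.Nat.Properties
  using (≤-reflexive; ≤-trans; ≤-antisym; <⇒≱; ≰⇒≥; ≤-pred; n≤1+n; +-suc; +-comm; +-cancelˡ-≤;
         m≤m+n; n≤0⇒n≡0; ≤⇒≤ᵇ; ≤ᵇ⇒≤; m≤n⇒m∸n≡0; 0∸n≡0; m+n∸m≡n; m+[n∸m]≡n; m≤n⇒∃[o]m+o≡n)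
open import Data.Product using (∃; ∃₂; _×_; _,_; proj₁; proj₂)
open import Data.Sum using (_⊎_; inj₁; inj₂)
open import Data.Vec using ([]; _∷_; tabulate; lookup; here; there)
open import Data.Vec.Properties using (lookup∘tabulate; []=⇒lookup; lookup⇒[]=)
open import Function using (_∘_; case_of_; Equivalence)
open import Relation.Nullary using (yes; no)
open import Relation.Binary.PropositionalEquality
  using (_≡_; _≢_; refl; sym; trans; cong; cong₂; subst; subst₂)

-- ℕ's _*_ is opened only in this block: below, the statement uses ℤ's _*_.
module _ where
  open import Data.Nat using (_*_)
  open import Data.Nat.Properties
    using (*-monoʳ-≤; *-distribʳ-+; *-zeroʳ; *-cancelˡ-≤; +-monoʳ-≤; +-monoˡ-≤; +-mono-≤; module ≤-Reasoning)
  open import Data.Nat.Tactic.RingSolver using (solve-∀)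

  ∈-tabulate⁺ : ∀ {n} {f : Fin n → Bool} {x} → f x ≡ true → x ∈ tabulate f
  ∈-tabulate⁺ {f = f} {x} fx = lookup⇒[]= x (tabulate f) (trans (lookup∘tabulate f x) fx)

  ∈-tabulate⁻ : ∀ {n} {f : Fin n → Bool} {x} → x ∈ tabulate f → f x ≡ true
  ∈-tabulate⁻ {f = f} {x} x∈ = trans (sym (lookup∘tabulate f x)) ([]=⇒lookup x∈)

  x∈p⇒0<∣p∣ : ∀ {n} {x : Fin n} {p : Subset n} → x ∈ p → 0 < ∣ p ∣
  x∈p⇒0<∣p∣ {x = x} x∈p =
    subst (_≤ _) (∣⁅x⁆∣≡1 x) (p⊆q⇒∣p∣≤∣q∣ λ y∈⁅x⁆ → subst (_∈ _) (sym (x∈⁅y⁆⇒x≡y x y∈⁅x⁆)) x∈p)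

  0<∣p∣⇒Nonempty : ∀ {n} {p : Subset n} → 0 < ∣ p ∣ → Nonempty p
  0<∣p∣⇒Nonempty {n} {p} 0<∣p∣ with nonempty? p
  ... | yes ne = ne
  ... | no empty = ⊥-elim (<⇒≱ 0<∣p∣ (≤-reflexive (trans (cong ∣_∣ (Empty-unique empty)) (∣⊥∣≡0 n))))

  ∣p∣≡0⇒p≡⊥ : ∀ {n} {p : Subset n} → ∣ p ∣ ≡ 0 → p ≡ ⊥
  ∣p∣≡0⇒p≡⊥ ∣p∣≡0 = Empty-unique λ (_ , x∈p) → case subst (0 <_) ∣p∣≡0 (x∈p⇒0<∣p∣ x∈p) of λ ()

  x≢y⇒1<∣p∣ : ∀ {n} {x y : Fin n} {p : Subset n} → x ∈ p → y ∈ p → x ≢ y → 1 < ∣ p ∣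
  x≢y⇒1<∣p∣ x∈p y∈p x≢y = ≤-trans (s≤s (x∈p⇒0<∣p∣ (x∈p∧x≢y⇒x∈p-y x∈p x≢y))) (x∈p⇒∣p-x∣<∣p∣ y∈p)

  ∣p∪q∣≤∣p∣+∣q∣ : ∀ {n} (p q : Subset n) → ∣ p ∪ q ∣ ≤ ∣ p ∣ + ∣ q ∣
  ∣p∪q∣≤∣p∣+∣q∣ []          []          = z≤n
  ∣p∪q∣≤∣p∣+∣q∣ (false ∷ p) (false ∷ q) = ∣p∪q∣≤∣p∣+∣q∣ p q
  ∣p∪q∣≤∣p∣+∣q∣ (false ∷ p) (true ∷ q)  =
    ≤-trans (s≤s (∣p∪q∣≤∣p∣+∣q∣ p q)) (≤-reflexive (sym (+-suc ∣ p ∣ ∣ q ∣)))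
  ∣p∪q∣≤∣p∣+∣q∣ (true ∷ p)  (false ∷ q) = s≤s (∣p∪q∣≤∣p∣+∣q∣ p q)
  ∣p∪q∣≤∣p∣+∣q∣ (true ∷ p)  (true ∷ q)  =
    s≤s (≤-trans (∣p∪q∣≤∣p∣+∣q∣ p q) (≤-trans (n≤1+n _) (≤-reflexive (sym (+-suc ∣ p ∣ ∣ q ∣)))))

  disjoint-∷⁻ : ∀ {n s t} {p q : Subset n} → (∀ {x} → x ∈ s ∷ p → x ∉ t ∷ q) → ∀ {x} → x ∈ p → x ∉ q
  disjoint-∷⁻ disjoint x∈p x∈q = disjoint (there x∈p) (there x∈q)

  disjoint⇒∣p∣+∣q∣≤∣p∪q∣ : ∀ {n} (p q : Subset n) → (∀ {x} → x ∈ p → x ∉ q) → ∣ p ∣ + ∣ q ∣ ≤ ∣ p ∪ q ∣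
  disjoint⇒∣p∣+∣q∣≤∣p∪q∣ []          []          _        = z≤n
  disjoint⇒∣p∣+∣q∣≤∣p∪q∣ (false ∷ p) (false ∷ q) disjoint = disjoint⇒∣p∣+∣q∣≤∣p∪q∣ p q (disjoint-∷⁻ disjoint)
  disjoint⇒∣p∣+∣q∣≤∣p∪q∣ (false ∷ p) (true ∷ q)  disjoint =
    ≤-trans (≤-reflexive (+-suc ∣ p ∣ ∣ q ∣)) (s≤s (disjoint⇒∣p∣+∣q∣≤∣p∪q∣ p q (disjoint-∷⁻ disjoint)))
  disjoint⇒∣p∣+∣q∣≤∣p∪q∣ (true ∷ p)  (false ∷ q) disjoint = s≤s (disjoint⇒∣p∣+∣q∣≤∣p∪q∣ p q (disjoint-∷⁻ disjoint))
  disjoint⇒∣p∣+∣q∣≤∣p∪q∣ (true ∷ p)  (true ∷ q)  disjoint = ⊥-elim (disjoint here here)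

  dropFirst : ∀ {n} → ℕ → Subset n → Subset n
  dropFirst k       []          = []
  dropFirst k       (false ∷ p) = false ∷ dropFirst k p
  dropFirst zero    (true ∷ p)  = true ∷ dropFirst zero p
  dropFirst (suc k) (true ∷ p)  = false ∷ dropFirst k p

  ∣dropFirst∣≡∣p∣∸k : ∀ {n} k (p : Subset n) → ∣ dropFirst k p ∣ ≡ ∣ p ∣ ∸ k
  ∣dropFirst∣≡∣p∣∸k k       []          = sym (0∸n≡0 k)
  ∣dropFirst∣≡∣p∣∸k k       (false ∷ p) = ∣dropFirst∣≡∣p∣∸k k p
  ∣dropFirst∣≡∣p∣∸k zero    (true ∷ p)  = cong suc (∣dropFirst∣≡∣p∣∸k zero p)
  ∣dropFirst∣≡∣p∣∸k (suc k) (true ∷ p)  = ∣dropFirst∣≡∣p∣∸k k p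

  ∣p─dropFirst∣≤k : ∀ {n} k (p : Subset n) → ∣ p ─ dropFirst k p ∣ ≤ k
  ∣p─dropFirst∣≤k k       []          = z≤n
  ∣p─dropFirst∣≤k k       (false ∷ p) = ∣p─dropFirst∣≤k k p
  ∣p─dropFirst∣≤k zero    (true ∷ p)  = ∣p─dropFirst∣≤k zero p
  ∣p─dropFirst∣≤k (suc k) (true ∷ p)  = s≤s (∣p─dropFirst∣≤k k p)

  iter-shift : ∀ {A : Set} (f : A → A) m a → iter m f (f a) ≡ f (iter m f a)
  iter-shift f zero    a = refl
  iter-shift f (suc m) a = cong f (iter-shift f m a)

  iter-fixedPoint : ∀ {A : Set} {f : A → A} {a} m → f a ≡ a → iter m f a ≡ a
  iter-fixedPoint zero    fa≡a = refl
  iter-fixedPoint {f = f} (suc m) fa≡a = trans (cong f (iter-fixedPoint m fa≡a)) fa≡a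

  anyFin⁺ : ∀ {n} (f : Fin n → Bool) v → f v ≡ true → anyFin f ≡ true
  anyFin⁺ f Fin.zero    fv = cong (_∨ anyFin (λ i → f (Fin.suc i))) fv
  anyFin⁺ f (Fin.suc v) fv = trans (cong (f Fin.zero ∨_) (anyFin⁺ (λ i → f (Fin.suc i)) v fv)) (∨-zeroʳ _)

  anyFin⁻ : ∀ {n} (f : Fin n → Bool) → anyFin f ≡ true → ∃ λ v → f v ≡ true
  anyFin⁻ {suc n} f any with f Fin.zero in f0
  ... | true  = Fin.zero , f0
  ... | false = let v , fv = anyFin⁻ (λ i → f (Fin.suc i)) any in Fin.suc v , fv

  ∧≡true⁻ : ∀ {x y} → x ∧ y ≡ true → x ≡ true × y ≡ true
  ∧≡true⁻ {true} {true} refl = refl , refl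

  ∨≡true⁻ : ∀ {x y} → x ∨ y ≡ true → x ≡ true ⊎ y ≡ true
  ∨≡true⁻ {true}  refl = inj₁ refl
  ∨≡true⁻ {false} y≡t  = inj₂ y≡t

  module _ {n : ℕ} (G : Graph n) where

    adj⇒≢ : ∀ {u v} → adj G u v ≡ true → u ≢ v
    adj⇒≢ {u} uv refl = case trans (sym uv) (irrefl G u) of λ ()

    N∩∁⁅v⁆≡N : ∀ v → N G v ∩ ∁ ⁅ v ⁆ ≡ N G v
    N∩∁⁅v⁆≡N v = ⊆-antisym (p∩q⊆p _ _) λ x∈N →
      x∈p∩q⁺ (x∈N , x∉p⇒x∈∁p (x≢y⇒x∉⁅y⁆ λ x≡v → adj⇒≢ (∈-tabulate⁻ x∈N) (sym x≡v)))

    connected⇒hasNbr : Connected G → ∀ {x} → 0 < deg G x → ∀ v → ∃ λ y → adj G v y ≡ true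
    connected⇒hasNbr conn {x} 0<deg v with 0<∣p∣⇒Nonempty 0<deg
    ... | z , z∈N with conn v z
    ... | here              = x , trans (adj-sym G z x) (∈-tabulate⁻ z∈N)
    ... | step {w = w} vw _ = w , vw

    boundaryEdge : ∀ {C : Subset n} {c w} → c ∈ C → w ∉ C → Reachable G c w →
      ∃₂ λ u y → u ∈ C × adj G u y ≡ true × y ∉ C
    boundaryEdge c∈C w∉C here = ⊥-elim (w∉C c∈C)
    boundaryEdge {C} c∈C w∉C (step {w = y} cy y⇝w) with y ∈? C
    ... | yes y∈C = boundaryEdge y∈C w∉C y⇝w
    ... | no  y∉C = _ , y , c∈C , cy , y∉C

    uncoloredNbrSet : Subset n → Fin n → Subset n
    uncoloredNbrSet S v = N G v ∩ ∁ S

    colored⇒∉uncoloredNbrSet : ∀ {S v x} → x ∈ S → x ∉ uncoloredNbrSet S v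
    colored⇒∉uncoloredNbrSet x∈S x∈U = x∈∁p⇒x∉p (proj₂ (x∈p∩q⁻ _ _ x∈U)) x∈S

    ∣S∣+∣uncoloredNbrSet∣≤∣S∪uncoloredNbrSet∣ : ∀ S v → ∣ S ∣ + ∣ uncoloredNbrSet S v ∣ ≤ ∣ S ∪ uncoloredNbrSet S v ∣
    ∣S∣+∣uncoloredNbrSet∣≤∣S∪uncoloredNbrSet∣ S v = disjoint⇒∣p∣+∣q∣≤∣p∪q∣ S _ colored⇒∉uncoloredNbrSet

    ∣uncoloredNbrSet⁅v⁆∣≡deg : ∀ v → ∣ uncoloredNbrSet ⁅ v ⁆ v ∣ ≡ deg G v
    ∣uncoloredNbrSet⁅v⁆∣≡deg v = cong ∣_∣ (N∩∁⁅v⁆≡N v)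

    coloredNbr⇒uncoloredNbrs<deg : ∀ {S u y} → adj G u y ≡ true → y ∈ S → uncoloredNbrs G S u < deg G u
    coloredNbr⇒uncoloredNbrs<deg uy y∈S =
      p⊂q⇒∣p∣<∣q∣ (p∩q⊆p _ _ , _ , ∈-tabulate⁺ uy , colored⇒∉uncoloredNbrSet y∈S)

    uncoloredNbrs-antimono : ∀ {S S′} v → S ⊆ S′ → uncoloredNbrs G S′ v ≤ uncoloredNbrs G S v
    uncoloredNbrs-antimono {S} {S′} v S⊆S′ = p⊆q⇒∣p∣≤∣q∣ {p = uncoloredNbrSet S′ v} λ x∈ →
      let x∈N , x∈∁S′ = x∈p∩q⁻ _ _ x∈ in x∈p∩q⁺ (x∈N , x∉p⇒x∈∁p λ x∈S → x∈∁p⇒x∉p x∈∁S′ (S⊆S′ x∈S))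

    Admissible : ℕ → Subset n → Set
    Admissible a C = ∀ {u} → u ∈ C → uncoloredNbrs G C u ≤ a

    coloredNbrs⇒admissible : ∀ {a C} → (∀ v → deg G v ≤ suc a) →
      (∀ {u} → u ∈ C → ∃ λ y → adj G u y ≡ true × y ∈ C) → Admissible a C
    coloredNbrs⇒admissible {C = C} maxDeg nbr u∈C =
      let _ , uy , y∈C = nbr u∈C in ≤-pred (≤-trans (coloredNbr⇒uncoloredNbrs<deg {C} uy y∈C) (maxDeg _))

    -- ⁅ v ⁆ ∪ N(v), written so that `expand` applies to it with C = ⁅ v ⁆
    closedNbhd : Fin n → Subset n
    closedNbhd v = ⁅ v ⁆ ∪ uncoloredNbrSet ⁅ v ⁆ v

    1+deg≤∣closedNbhd∣ : ∀ v → suc (deg G v) ≤ ∣ closedNbhd v ∣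
    1+deg≤∣closedNbhd∣ v = ≤-trans (≤-reflexive (sym (cong₂ _+_ (∣⁅x⁆∣≡1 v) (∣uncoloredNbrSet⁅v⁆∣≡deg v))))
                                   (∣S∣+∣uncoloredNbrSet∣≤∣S∪uncoloredNbrSet∣ ⁅ v ⁆ v)

    closedNbhd-admissible : ∀ {a v y} → (∀ u → deg G u ≤ suc a) → adj G v y ≡ true → Admissible a (closedNbhd v)
    closedNbhd-admissible {v = v} {y} maxDeg vy = coloredNbrs⇒admissible maxDeg nbr
      where
      v∈ : v ∈ closedNbhd v
      v∈ = p⊆p∪q _ (x∈⁅x⁆ v)
      nbr : ∀ {u} → u ∈ closedNbhd v → ∃ λ z → adj G u z ≡ true × z ∈ closedNbhd v
      nbr u∈ with x∈p∪q⁻ ⁅ v ⁆ _ u∈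
      ... | inj₁ u∈⁅v⁆ rewrite x∈⁅y⁆⇒x≡y v u∈⁅v⁆ =
        y , vy , q⊆p∪q ⁅ v ⁆ _ (subst (y ∈_) (sym (N∩∁⁅v⁆≡N v)) (∈-tabulate⁺ vy))
      ... | inj₂ u∈U = v , trans (adj-sym G _ v) (∈-tabulate⁻ (subst (_ ∈_) (N∩∁⁅v⁆≡N v) u∈U)) , v∈

  module _ {n : ℕ} (k : ℕ) (G : Graph n) where

    forces : Subset n → Fin n → Fin n → Bool
    forces S v w = lookup S v ∧ adj G v w ∧ (uncoloredNbrs G S v ≤ᵇ k)

    colored⇒∈forceStep : ∀ {S x} → x ∈ S → x ∈ forceStep k G S
    colored⇒∈forceStep {S} {x} x∈S = ∈-tabulate⁺ (cong (_∨ anyFin (λ v → forces S v x)) ([]=⇒lookup x∈S))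

    forced⇒∈forceStep : ∀ {S v x} → v ∈ S → adj G v x ≡ true → uncoloredNbrs G S v ≤ k → x ∈ forceStep k G S
    forced⇒∈forceStep {S} {v} {x} v∈S vx few =
      ∈-tabulate⁺ (trans (cong (lookup S x ∨_) (anyFin⁺ _ v vForces)) (∨-zeroʳ _))
      where
      vForces : forces S v x ≡ true
      vForces rewrite []=⇒lookup v∈S | vx = Equivalence.to T-≡ (≤⇒≤ᵇ few)

    ∈forceStep⁻ : ∀ {S x} → x ∈ forceStep k G S →
      x ∈ S ⊎ ∃ λ v → v ∈ S × adj G v x ≡ true × uncoloredNbrs G S v ≤ k
    ∈forceStep⁻ {S} {x} x∈ with ∨≡true⁻ (∈-tabulate⁻ x∈)
    ... | inj₁ Sx  = inj₁ (lookup⇒[]= x S Sx)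
    ... | inj₂ any =
      let v , vForces = anyFin⁻ _ any
          Sv , rest   = ∧≡true⁻ vForces
          vx , few    = ∧≡true⁻ rest
      in inj₂ (v , lookup⇒[]= v S Sv , vx , ≤ᵇ⇒≤ _ _ (Equivalence.from T-≡ few))

    forceStep-mono : ∀ {S S′} → S ⊆ S′ → forceStep k G S ⊆ forceStep k G S′
    forceStep-mono S⊆S′ x∈ with ∈forceStep⁻ x∈
    ... | inj₁ x∈S               = colored⇒∈forceStep (S⊆S′ x∈S)
    ... | inj₂ (v , v∈S , vx , few) =
      forced⇒∈forceStep (S⊆S′ v∈S) vx (≤-trans (uncoloredNbrs-antimono G v S⊆S′) few)

    iter-forceStep-mono : ∀ m {S S′} → S ⊆ S′ → iter m (forceStep k G) S ⊆ iter m (forceStep k G) S′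
    iter-forceStep-mono zero    S⊆S′ = S⊆S′
    iter-forceStep-mono (suc m) S⊆S′ = forceStep-mono (iter-forceStep-mono m S⊆S′)

    ⊆forceStep⇒forcingSet : ∀ {S S′} → S′ ⊆ forceStep k G S → IsKForcingSet k G S′ → IsKForcingSet k G S
    ⊆forceStep⇒forcingSet {S} S′⊆ (m , S′↠⊤) = suc m , ⊆-antisym ⊆⊤ λ {x} _ →
      subst (x ∈_) (iter-shift (forceStep k G) m S) (iter-forceStep-mono m S′⊆ (subst (x ∈_) (sym S′↠⊤) ∈⊤))

    expand : ∀ {C T u} → u ∈ C →
      IsKForcingSet k G ((C ∪ uncoloredNbrSet G C u) ∪ T) →
      IsKForcingSet k G (C ∪ (dropFirst k (uncoloredNbrSet G C u) ∪ T))
    expand {C} {T} {u} u∈C = ⊆forceStep⇒forcingSet covered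
      where
      U D : Subset n
      U = uncoloredNbrSet G C u
      D = C ∪ (dropFirst k U ∪ T)
      C⊆D : C ⊆ D
      C⊆D = p⊆p∪q _
      fewLeft : uncoloredNbrs G D u ≤ k
      fewLeft = ≤-trans (p⊆q⇒∣p∣≤∣q∣ leftover) (∣p─dropFirst∣≤k k U)
        where
        leftover : uncoloredNbrSet G D u ⊆ U ─ dropFirst k U
        leftover x∈ =
          let x∈N , x∈∁D = x∈p∩q⁻ _ _ x∈
              x∉D = x∈∁p⇒x∉p x∈∁D
          in x∈p∧x∉q⇒x∈p─q (x∈p∩q⁺ (x∈N , x∉p⇒x∈∁p (x∉D ∘ C⊆D)))
                            (x∉D ∘ q⊆p∪q C _ ∘ p⊆p∪q T)
      covered : (C ∪ U) ∪ T ⊆ forceStep k G D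
      covered x∈ with x∈p∪q⁻ _ _ x∈
      ... | inj₂ x∈T = colored⇒∈forceStep (q⊆p∪q C _ (q⊆p∪q _ T x∈T))
      ... | inj₁ x∈C∪U with x∈p∪q⁻ C U x∈C∪U
      ... | inj₁ x∈C = colored⇒∈forceStep (C⊆D x∈C)
      ... | inj₂ x∈U = forced⇒∈forceStep (C⊆D u∈C) (∈-tabulate⁻ (proj₁ (x∈p∩q⁻ _ _ x∈U))) fewLeft

    Stalled : Subset n → Set
    Stalled S = ∀ {v} → v ∈ S → k < uncoloredNbrs G S v

    stalled⇒forceStep≡ : ∀ {S} → Stalled S → forceStep k G S ≡ S
    stalled⇒forceStep≡ {S} stalled = ⊆-antisym noForce colored⇒∈forceStep
      where
      noForce : forceStep k G S ⊆ S
      noForce x∈ with ∈forceStep⁻ x∈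
      ... | inj₁ x∈S               = x∈S
      ... | inj₂ (_ , v∈S , _ , few) = ⊥-elim (<⇒≱ (stalled v∈S) few)

    stalled-forcingSet≡⊤ : ∀ {S} → Stalled S → IsKForcingSet k G S → S ≡ ⊤
    stalled-forcingSet≡⊤ stalled (m , S↠⊤) = trans (sym (iter-fixedPoint m (stalled⇒forceStep≡ stalled))) S↠⊤

    forcingSet⇒0<∣S∣ : Fin n → ∀ {S} → IsKForcingSet k G S → 0 < ∣ S ∣
    forcingSet⇒0<∣S∣ v {S} forcing with nonempty? S
    ... | yes (_ , x∈S) = x∈p⇒0<∣p∣ x∈S
    ... | no empty      = ⊥-elim (empty (v , subst (v ∈_) (sym S≡⊤) ∈⊤))
      where
      S≡⊤ : S ≡ ⊤
      S≡⊤ = stalled-forcingSet≡⊤ (λ v∈S → ⊥-elim (empty (_ , v∈S))) forcing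

    -- a set with at most one member is stalled when all degrees exceed k
    forcingSet⇒1<∣S∣ : (∀ v → k < deg G v) → ∀ {u w} → adj G u w ≡ true →
      ∀ {S} → IsKForcingSet k G S → 1 < ∣ S ∣
    forcingSet⇒1<∣S∣ bigDeg {u} {w} uw {S} forcing with 2 ≤? ∣ S ∣
    ... | yes 1<∣S∣ = 1<∣S∣
    ... | no ¬1<∣S∣ = ⊥-elim (¬1<∣S∣ (x≢y⇒1<∣p∣ (∈S u) (∈S w) (adj⇒≢ G uw)))
      where
      stalled : Stalled S
      stalled {v} v∈S = ≤-trans (bigDeg v) (p⊆q⇒∣p∣≤∣q∣ λ x∈N →
        x∈p∩q⁺ (x∈N , x∉p⇒x∈∁p λ x∈S → ¬1<∣S∣ (x≢y⇒1<∣p∣ v∈S x∈S (adj⇒≢ G (∈-tabulate⁻ x∈N)))))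
      ∈S : ∀ x → x ∈ S
      ∈S x = subst (x ∈_) (sym (stalled-forcingSet≡⊤ stalled forcing)) ∈⊤

  [b+k]*[r∸k]≤b*r : ∀ b k r → r ≤ b + k → (b + k) * (r ∸ k) ≤ b * r
  [b+k]*[r∸k]≤b*r b k r r≤b+k with r ≤? k
  ... | yes r≤k rewrite m≤n⇒m∸n≡0 r≤k | *-zeroʳ (b + k) = z≤n
  ... | no r≰k with m≤n⇒∃[o]m+o≡n (≰⇒≥ r≰k)
  ... | s , refl rewrite m+n∸m≡n k s = begin
    (b + k) * s   ≡⟨ *-distribʳ-+ s b k ⟩
    b * s + k * s ≤⟨ +-monoʳ-≤ (b * s) (*-monoʳ-≤ k s≤b) ⟩
    b * s + k * b ≡⟨ distrib b k s ⟩
    b * (k + s)   ∎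
    where
    open ≤-Reasoning
    s≤b : s ≤ b
    s≤b = +-cancelˡ-≤ k s b (≤-trans r≤b+k (≤-reflexive (+-comm b k)))
    distrib : ∀ b k s → b * s + k * b ≡ b * (k + s)
    distrib = solve-∀

  -- Δ = 1 + b + k bounds the degrees, so Δ − 1 = b + k and Δ − k − 1 = b.
  module Greedy {n : ℕ} (k b : ℕ) (G : Graph n) (conn : Connected G) (maxDeg : ∀ v → deg G v ≤ suc (b + k)) where

    CheapCompletion : Subset n → Set
    CheapCompletion C = ∃ λ T → IsKForcingSet k G (C ∪ T) × (b + k) * ∣ T ∣ + b * ∣ C ∣ ≤ b * n

    admissible-extend : ∀ {C u} → Admissible G (b + k) C → u ∈ C →
      Admissible G (b + k) (C ∪ uncoloredNbrSet G C u)
    admissible-extend {C} {u} adm u∈C {x} x∈ with x∈p∪q⁻ C _ x∈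
    ... | inj₁ x∈C = ≤-trans (uncoloredNbrs-antimono G x (p⊆p∪q _)) (adm x∈C)
    ... | inj₂ x∈U = ≤-pred (≤-trans (coloredNbr⇒uncoloredNbrs<deg G xu (p⊆p∪q _ u∈C)) (maxDeg x))
      where
      xu : adj G x u ≡ true
      xu = trans (adj-sym G x u) (∈-tabulate⁻ (proj₁ (x∈p∩q⁻ _ _ x∈U)))

    full⇒cheapCompletion : ∀ {C} → (∀ x → x ∈ C) → CheapCompletion C
    full⇒cheapCompletion {C} full = ⊥ , (0 , ⊆-antisym ⊆⊤ λ {x} _ → p⊆p∪q ⊥ (full x)) , bound
      where
      bound : (b + k) * ∣ ⊥ {n = n} ∣ + b * ∣ C ∣ ≤ b * n
      bound rewrite ∣⊥∣≡0 n | *-zeroʳ (b + k) = *-monoʳ-≤ b (∣p∣≤n C)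

    extend : ∀ {C u} → Admissible G (b + k) C → u ∈ C →
      CheapCompletion (C ∪ uncoloredNbrSet G C u) → CheapCompletion C
    extend {C} {u} adm u∈C (T , forcing , bound) = A ∪ T , expand k G u∈C forcing , count
      where
      U A : Subset n
      U = uncoloredNbrSet G C u
      A = dropFirst k U
      a : ℕ
      a = b + k
      ∣A∣-cost : a * ∣ A ∣ ≤ b * ∣ U ∣
      ∣A∣-cost rewrite ∣dropFirst∣≡∣p∣∸k k U = [b+k]*[r∸k]≤b*r b k ∣ U ∣ (adm u∈C)
      count : a * ∣ A ∪ T ∣ + b * ∣ C ∣ ≤ b * n
      count = begin
        a * ∣ A ∪ T ∣ + b * ∣ C ∣               ≤⟨ +-monoˡ-≤ (b * ∣ C ∣) (*-monoʳ-≤ a (∣p∪q∣≤∣p∣+∣q∣ A T)) ⟩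
        a * (∣ A ∣ + ∣ T ∣) + b * ∣ C ∣         ≡⟨ distrib a ∣ A ∣ ∣ T ∣ (b * ∣ C ∣) ⟩
        a * ∣ A ∣ + (a * ∣ T ∣ + b * ∣ C ∣)     ≤⟨ +-monoˡ-≤ _ ∣A∣-cost ⟩
        b * ∣ U ∣ + (a * ∣ T ∣ + b * ∣ C ∣)     ≡⟨ regroup b (a * ∣ T ∣) ∣ C ∣ ∣ U ∣ ⟩
        a * ∣ T ∣ + b * (∣ C ∣ + ∣ U ∣)         ≤⟨ +-monoʳ-≤ (a * ∣ T ∣) (*-monoʳ-≤ b ∣C∣+∣U∣≤) ⟩
        a * ∣ T ∣ + b * ∣ C ∪ U ∣               ≤⟨ bound ⟩
        b * n                                   ∎
        where
        open ≤-Reasoning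
        ∣C∣+∣U∣≤ : ∣ C ∣ + ∣ U ∣ ≤ ∣ C ∪ U ∣
        ∣C∣+∣U∣≤ = ∣S∣+∣uncoloredNbrSet∣≤∣S∪uncoloredNbrSet∣ G C u
        distrib : ∀ a x t c → a * (x + t) + c ≡ a * x + (a * t + c)
        distrib = solve-∀
        regroup : ∀ b t c u → b * u + (t + b * c) ≡ t + b * (c + u)
        regroup = solve-∀

    greedy : ∀ {C} → Nonempty C → Admissible G (b + k) C → CheapCompletion C
    greedy = go n (m≤m+n n _)
      where
      go : ∀ m {C} → n ≤ m + ∣ C ∣ → Nonempty C → Admissible G (b + k) C → CheapCompletion C
      go m {C} fuel (c , c∈C) adm with all? (_∈? C)
      ... | yes full  = full⇒cheapCompletion full
      ... | no ¬full with ¬∀⟶∃¬ n _ (_∈? C) ¬full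
      ... | w , w∉C with boundaryEdge G c∈C w∉C (conn _ w)
      ... | u , y , u∈C , uy , y∉C = extend adm u∈C (grow m fuel)
        where
        U : Subset n
        U = uncoloredNbrSet G C u
        grow : ∀ m → n ≤ m + ∣ C ∣ → CheapCompletion (C ∪ U)
        grow zero    fuel = ⊥-elim (<⇒≱ (subst (∣ C ∣ <_) (∣⊤∣≡n n) (p⊂q⇒∣p∣<∣q∣ (⊆⊤ , w , ∈⊤ , w∉C))) fuel)
        grow (suc m) fuel = go m fuel′ (c , p⊆p∪q U c∈C) (admissible-extend adm u∈C)
          where
          y∈U : y ∈ U
          y∈U = x∈p∩q⁺ (∈-tabulate⁺ uy , x∉p⇒x∈∁p y∉C)
          fuel′ : n ≤ m + ∣ C ∪ U ∣
          fuel′ = begin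
            n                   ≤⟨ fuel ⟩
            suc m + ∣ C ∣         ≡⟨ +-suc m ∣ C ∣ ⟨
            m + (1 + ∣ C ∣)       ≤⟨ +-monoʳ-≤ m (+-monoˡ-≤ ∣ C ∣ (x∈p⇒0<∣p∣ y∈U)) ⟩
            m + (∣ U ∣ + ∣ C ∣)   ≡⟨ cong (m +_) (+-comm ∣ U ∣ ∣ C ∣) ⟩
            m + (∣ C ∣ + ∣ U ∣)   ≤⟨ +-monoʳ-≤ m (∣S∣+∣uncoloredNbrSet∣≤∣S∪uncoloredNbrSet∣ G C u) ⟩
            m + ∣ C ∪ U ∣        ∎
            where open ≤-Reasoning

    forcingNumber-bound : ∀ {v y d F} → adj G v y ≡ true → deg G v ≡ d → IsKForcingNumber k G F →
      (b + k) * F + b * suc d ≤ b * n + (b + k) * suc (d ∸ k)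
    forcingNumber-bound {v} {y} {F = F} vy refl (_ , minimal) =
      fromCompletion (greedy (v , p⊆p∪q _ (x∈⁅x⁆ v)) (closedNbhd-admissible G maxDeg vy))
      where
      a : ℕ
      a = b + k
      A : Subset n
      A = dropFirst k (uncoloredNbrSet G ⁅ v ⁆ v)
      ∣A∣≡ : ∣ A ∣ ≡ deg G v ∸ k
      ∣A∣≡ = trans (∣dropFirst∣≡∣p∣∸k k (uncoloredNbrSet G ⁅ v ⁆ v)) (cong (_∸ k) (∣uncoloredNbrSet⁅v⁆∣≡deg G v))
      fromCompletion : CheapCompletion (closedNbhd G v) → a * F + b * suc (deg G v) ≤ b * n + a * suc (deg G v ∸ k)
      fromCompletion (T , forcing , bound) = begin
        a * F + b * suc (deg G v)                       ≤⟨ +-mono-≤ (*-monoʳ-≤ a F≤) (*-monoʳ-≤ b (1+deg≤∣closedNbhd∣ G v)) ⟩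
        a * (1 + (∣ A ∣ + ∣ T ∣)) + b * ∣ closedNbhd G v ∣    ≡⟨ distrib a ∣ A ∣ ∣ T ∣ _ ⟩
        a * (1 + ∣ A ∣) + (a * ∣ T ∣ + b * ∣ closedNbhd G v ∣) ≤⟨ +-monoʳ-≤ _ bound ⟩
        a * (1 + ∣ A ∣) + b * n                         ≡⟨ +-comm _ (b * n) ⟩
        b * n + a * (1 + ∣ A ∣)                         ≡⟨ cong (λ r → b * n + a * suc r) ∣A∣≡ ⟩
        b * n + a * suc (deg G v ∸ k)                   ∎
        where
        open ≤-Reasoning
        F≤ : F ≤ 1 + (∣ A ∣ + ∣ T ∣)
        F≤ = ≤-trans (minimal _ (expand k G (x∈⁅x⁆ v) forcing))
               (≤-trans (∣p∪q∣≤∣p∣+∣q∣ ⁅ v ⁆ (A ∪ T))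
                 (≤-trans (≤-reflexive (cong (_+ ∣ A ∪ T ∣) (∣⁅x⁆∣≡1 v))) (s≤s (∣p∪q∣≤∣p∣+∣q∣ A T))))
        distrib : ∀ a x t c → a * (1 + (x + t)) + c ≡ a * (1 + x) + (a * t + c)
        distrib = solve-∀

  module _ {n : ℕ} (k : ℕ) .{{_ : NonZero k}} (G : Graph n) (conn : Connected G)
           (maxDeg : ∀ v → deg G v ≤ suc k) where
    open Greedy k 0 G conn maxDeg

    regular-forcingSet : ∀ {C} → Nonempty C → Admissible G k C → IsKForcingSet k G C
    regular-forcingSet {C} ne adm with greedy ne adm
    ... | T , forcing , bound = subst (IsKForcingSet k G) C∪T≡C forcing
      where
      ∣T∣≡0 : ∣ T ∣ ≡ 0
      ∣T∣≡0 = n≤0⇒n≡0 (*-cancelˡ-≤ k (≤-trans (m≤m+n (k * ∣ T ∣) 0) (≤-trans bound z≤n)))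
      C∪T≡C : C ∪ T ≡ C
      C∪T≡C = trans (cong (C ∪_) (∣p∣≡0⇒p≡⊥ ∣T∣≡0)) (∪-identityʳ C)

    lowDegree⇒isKForcingNumber1 : ∀ {v} → deg G v ≤ k → IsKForcingNumber k G 1
    lowDegree⇒isKForcingNumber1 {v} deg≤k =
      (⁅ v ⁆ , regular-forcingSet (v , x∈⁅x⁆ v) admissible , ∣⁅x⁆∣≡1 v) , λ _ → forcingSet⇒0<∣S∣ k G v
      where
      admissible : Admissible G k ⁅ v ⁆
      admissible u∈ rewrite x∈⁅y⁆⇒x≡y v u∈ = ≤-trans (∣p∩q∣≤∣p∣ (N G v) _) deg≤k

    regular⇒isKForcingNumber2 : (∀ v → k < deg G v) → ∀ {v y} → adj G v y ≡ true → IsKForcingNumber k G 2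
    regular⇒isKForcingNumber2 bigDeg {v} {y} vy =
      (C , regular-forcingSet (v , v∈C) admissible , ∣C∣≡2) , λ _ → forcingSet⇒1<∣S∣ k G bigDeg vy
      where
      C : Subset n
      C = ⁅ v ⁆ ∪ ⁅ y ⁆
      v∈C : v ∈ C
      v∈C = p⊆p∪q ⁅ y ⁆ (x∈⁅x⁆ v)
      y∈C : y ∈ C
      y∈C = q⊆p∪q ⁅ v ⁆ ⁅ y ⁆ (x∈⁅x⁆ y)
      admissible : Admissible G k C
      admissible = coloredNbrs⇒admissible G maxDeg nbr
        where
        nbr : ∀ {u} → u ∈ C → ∃ λ z → adj G u z ≡ true × z ∈ C
        nbr u∈ with x∈p∪q⁻ ⁅ v ⁆ ⁅ y ⁆ u∈
        ... | inj₁ u∈⁅v⁆ rewrite x∈⁅y⁆⇒x≡y v u∈⁅v⁆ = y , vy , y∈C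
        ... | inj₂ u∈⁅y⁆ rewrite x∈⁅y⁆⇒x≡y y u∈⁅y⁆ = v , trans (adj-sym G y v) vy , v∈C
      ∣C∣≡2 : ∣ C ∣ ≡ 2
      ∣C∣≡2 = ≤-antisym (≤-trans (∣p∪q∣≤∣p∣+∣q∣ ⁅ v ⁆ ⁅ y ⁆) (≤-reflexive (cong₂ _+_ (∣⁅x⁆∣≡1 v) (∣⁅x⁆∣≡1 y))))
                        (x≢y⇒1<∣p∣ v∈C y∈C (adj⇒≢ G vy))

import Data.Nat as ℕ
open import Data.Integer using (ℤ; +_; _*_; _-_; _⊔_; -_; +≤+) renaming (_+_ to _+ℤ_; _≤_ to _≤ℤ_)
import Data.Integer.Properties as ℤ
open import Data.Integer.Tactic.RingSolver using (solve-∀)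

correction : ℕ → ℕ → ℕ → ℤ
correction k δ Δ = (+ δ * (+ k +ℤ + 1 - + Δ) +ℤ + k) ⊔ (+ k * (+ δ - + Δ +ℤ + 2))

-- The left-hand side equals the first term of the maximum when δ ≤ k and the second one otherwise.
excess≤correction : ∀ b k δ → + (b + k) * + suc (δ ∸ k) - + b * + suc δ ≤ℤ correction k δ (suc (b + k))
excess≤correction b k δ with δ ≤? k
... | yes δ≤k rewrite m≤n⇒m∸n≡0 δ≤k =
  ℤ.≤-trans (ℤ.≤-reflexive (identity (+ b) (+ k) (+ δ))) (ℤ.i≤i⊔j _ _)
  where
  identity : ∀ B K D → (B +ℤ K) * + 1 - B * (+ 1 +ℤ D) ≡ D * (K +ℤ + 1 - (+ 1 +ℤ (B +ℤ K))) +ℤ K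
  identity = solve-∀
... | no δ≰k with m≤n⇒∃[o]m+o≡n (≰⇒≥ δ≰k)
... | e , refl rewrite m+n∸m≡n k e =
  ℤ.≤-trans (ℤ.≤-reflexive (identity (+ b) (+ k) (+ e))) (ℤ.i≤j⊔i _ _)
  where
  identity : ∀ B K E →
    (B +ℤ K) * (+ 1 +ℤ E) - B * (+ 1 +ℤ (K +ℤ E)) ≡ K * ((K +ℤ E) - (+ 1 +ℤ (B +ℤ K)) +ℤ + 2)
  identity = solve-∀

forcingBound-ℤ : ∀ k b δ n F {Δ} → Δ ≡ suc (b + k) →
  (b + k) ℕ.* F + b ℕ.* suc δ ≤ b ℕ.* n + (b + k) ℕ.* suc (δ ∸ k) →
  (+ Δ - + 1) * + F ≤ℤ (+ Δ - + k - + 1) * + n +ℤ correction k δ Δ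
forcingBound-ℤ k b δ n F refl h = begin
  (+ Δ - + 1) * + F                            ≡⟨ shift A (+ F) Y ⟩
  A * + F +ℤ Y - Y                             ≤⟨ ℤ.+-monoˡ-≤ (- Y) hℤ ⟩
  + b * + n +ℤ X - Y                           ≡⟨ regroup (+ b) (+ k) (+ n) X Y ⟩
  (+ Δ - + k - + 1) * + n +ℤ (X - Y)           ≤⟨ ℤ.+-monoʳ-≤ ((+ Δ - + k - + 1) * + n) (excess≤correction b k δ) ⟩
  (+ Δ - + k - + 1) * + n +ℤ correction k δ Δ  ∎
  where
  open ℤ.≤-Reasoning
  Δ : ℕ
  Δ = suc (b + k)
  A X Y : ℤ
  A = + (b + k)
  X = A * + suc (δ ∸ k)
  Y = + b * + suc δ
  hℤ : A * + F +ℤ Y ≤ℤ + b * + n +ℤ X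
  hℤ = subst₂ _≤ℤ_ (cong₂ _+ℤ_ (ℤ.pos-* (b + k) F) (ℤ.pos-* b (suc δ)))
                   (cong₂ _+ℤ_ (ℤ.pos-* b n) (ℤ.pos-* (b + k) (suc (δ ∸ k)))) (+≤+ h)
  shift : ∀ A F Y → (+ 1 +ℤ A - + 1) * F ≡ A * F +ℤ Y - Y
  shift = solve-∀
  regroup : ∀ B K N X Y → B * N +ℤ X - Y ≡ (+ 1 +ℤ (B +ℤ K) - K - + 1) * N +ℤ (X - Y)
  regroup = solve-∀

theorem1 : (k : ℕ) → .{{_ : NonZero k}} → (n : ℕ) → (G : Graph n) → Connected G →
    (δ Δ : ℕ) → IsMinDegree G δ → IsMaxDegree G Δ → suc k ≤ Δ →
    ((δ < Δ → Δ ≡ suc k → IsKForcingNumber k G 1) ×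
     (δ ≡ suc k → Δ ≡ suc k → IsKForcingNumber k G 2) ×
     (suc (suc k) ≤ Δ → (F : ℕ) → IsKForcingNumber k G F →
       (+ Δ - + 1) * + F ≤ℤ
         (+ Δ - + k - + 1) * + n
           +ℤ ((+ δ * (+ k +ℤ + 1 - + Δ) +ℤ + k) ⊔ (+ k * (+ δ - + Δ +ℤ + 2)))))
theorem1 k n G conn δ Δ (δ≤deg , v , degv≡δ) (deg≤Δ , w , degw≡Δ) k<Δ
  with connected⇒hasNbr G conn (subst (0 <_) (sym degw≡Δ) (≤-trans (s≤s z≤n) k<Δ)) v
... | y , vy =
    (λ δ<Δ Δ≡ → lowDegree⇒isKForcingNumber1 k G conn (maxDeg Δ≡)
                  (≤-trans (≤-reflexive degv≡δ) (≤-pred (subst (δ <_) Δ≡ δ<Δ))))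
  , (λ δ≡ Δ≡ → regular⇒isKForcingNumber2 k G conn (maxDeg Δ≡) (λ u → subst (_≤ deg G u) δ≡ (δ≤deg u)) vy)
  , (λ _ F isF → forcingBound-ℤ k b δ n F Δ≡ (Greedy.forcingNumber-bound k b G conn (maxDeg Δ≡) vy degv≡δ isF))
  where
  maxDeg : ∀ {d} → Δ ≡ d → ∀ u → deg G u ≤ d
  maxDeg Δ≡d u = subst (deg G u ≤_) Δ≡d (deg≤Δ u)
  b : ℕ
  b = Δ ∸ suc k
  Δ≡ : Δ ≡ suc (b + k)
  Δ≡ = trans (sym (m+[n∸m]≡n k<Δ)) (cong suc (+-comm k b))
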